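{- Let $r\ge 2$, $t\ge 1$ and $k\ge 3$ be integers. Then, as $n\to\infty$ (with $r,t,k$ fixed), $\mathrm{ex}_r(n,F_{t,k}^r)=\Theta(n^r)$ if $k>r$, and $\mathrm{ex}_r(n,F_{t,k}^r)=\Theta(n^{r-1})$ if $2<k\le r$.
   Context: $F_{t,k}$ (the $(t,k)$-fan) is the graph on $(k-1)t+1$ vertices consisting of $t$ copies of $K_k$ sharing exactly one common vertex. For a graph $F$, its $r$-expansion $F^r$ is the $r$-graph obtained from $F$ by adding $r-2$ new vertices to each edge of $F$, with all $(r-2)|E(F)|$ new vertices distinct from each other and not in $V(F)$. $\mathrm{ex}_r(n,\mathcal{F})$ is the maximum number of hyperedges in an $n$-vertex $r$-uniform hypergraph not containing $\mathcal{F}$ as a subhypergraph. -}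

module Defs where

open import Data.Nat using (ℕ; _≤_; _*_; _^_; _∸_)
open import Data.Fin using (Fin; _<?_)
open import Data.Fin.Base using ()
import Data.List
open import Data.List using (List; []; _∷_; length; map; concatMap; allFin; tabulate; lookup; filter)
open import Data.List.Relation.Unary.All using (All)
open import Data.List.Relation.Unary.Any using (Any)
open import Data.List.Relation.Unary.AllPairs using (AllPairs)
open import Data.List.Relation.Unary.Unique.Propositional using (Unique)
open import Data.List.Relation.Binary.Permutation.Propositional using (_↭_)
open import Data.Maybe using (Maybe; just; nothing)
open import Data.Product using (Σ; _×_; _,_; ∃)
open import Data.Sum using (_⊎_; inj₁; inj₂)
open import Relation.Binary.PropositionalEquality using (_≡_)
open import Relation.Nullary using (¬_)
open import Function.Definitions using (Injective)

-- An r-uniform hypergraph on vertex set Fin n.  A hyperedge is a list of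
-- r distinct vertices (read as a set); distinct hyperedges are distinct as
-- sets (no two are permutations of each other).
record RGraph (r n : ℕ) : Set where
  field
    edges   : List (List (Fin n))
    uniform : All (λ e → (length e ≡ r) × Unique e) edges
    simple  : AllPairs (λ e f → ¬ (e ↭ f)) edges
open RGraph public

∣E∣ : ∀ {r n} → RGraph r n → ℕ
∣E∣ H = length (edges H)

Contains : ∀ {r n} {V : Set} → RGraph r n → List (List V) → Set
Contains {n = n} {V} H G =
  Σ (V → Fin n) λ φ →
    Injective _≡_ _≡_ φ × All (λ e → Any (λ h → map φ e ↭ h) (edges H)) G

Free : ∀ {r n} {V : Set} → RGraph r n → List (List V) → Set
Free H G = ¬ Contains H G

-- r-expansion of a graph with vertex type V and edge list E:
-- vertices V ⊎ (Fin |E| × Fin (r-2)); the i-th edge uw becomes the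
-- hyperedge {u, w} ∪ {(i,0), …, (i,r-3)}.
ExpVertex : Set → ℕ → ℕ → Set
ExpVertex V m r = V ⊎ (Fin m × Fin (r ∸ 2))

expansion : {V : Set} → (r : ℕ) → (E : List (V × V)) →
            List (List (ExpVertex V (length E) r))
expansion {V} r E = tabulate edge
  where
  edge : Fin (length E) → List (ExpVertex V (length E) r)
  edge i with lookup E i
  ... | (u , w) = inj₁ u ∷ inj₁ w ∷ map (λ j → inj₂ (i , j)) (allFin (r ∸ 2))

-- The (t,k)-fan F_{t,k}: t copies of K_k sharing one vertex.
-- Vertices: nothing = the common centre, just (a , i) = the i-th
-- non-central vertex (i < k-1) of the a-th copy; (k-1)t+1 vertices.
FanVertex : ℕ → ℕ → Set
FanVertex t k = Maybe (Fin t × Fin (k ∸ 1))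

fanEdges : (t k : ℕ) → List (FanVertex t k × FanVertex t k)
fanEdges t k = concatMap copy (allFin t)
  where
  copy : Fin t → List (FanVertex t k × FanVertex t k)
  copy a =
    map (λ i → (nothing , just (a , i))) (allFin (k ∸ 1))
    Data.List.++
    concatMap (λ i → map (λ j → (just (a , i) , just (a , j)))
                         (filter (λ j → i <? j) (allFin (k ∸ 1))))
              (allFin (k ∸ 1))

fanExp : (r t k : ℕ) → List (List (ExpVertex (FanVertex t k) (length (fanEdges t k)) r))
fanExp r t k = expansion r (fanEdges t k)

-- ex_r(n, F) = Θ(n^d) as n → ∞, written out via the definition of ex as a
-- maximum: there are constants c, C, N such that for all n ≥ N
--  * some F-free r-graph on n vertices has at least n^d / c edges, and
--  * every F-free r-graph on n vertices has at most C · n^d edges.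
ExTheta : {V : Set} → (r : ℕ) → List (List V) → (d : ℕ) → Set
ExTheta r F d =
  Σ ℕ λ c → Σ ℕ λ C → Σ ℕ λ N → ∀ n → N ≤ n →
    (Σ (RGraph r n) λ H → Free H F × (n ^ d ≤ c * ∣E∣ H))
    × (∀ (H : RGraph r n) → Free H F → ∣E∣ H ≤ C * n ^ d)

{-# OPTIONS --safe #-}
module Submission where

-- For k > r the complete r-partite r-graph with parts of size m = ⌊n/r⌋ has m^r edges
-- and contains no F^r_{t,k}: the parts colour every edge properly with r colours, so two of the k
-- pairwise adjacent vertices of a copy of K_k get the same colour, although some edge contains both.
-- For k ≤ r, shrinking the first part to a single vertex z leaves m^(r-1) edges, all through z; but
-- the preimage of z would have to lie in the three expanded edges of a triangle, which share no vertex.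
--
-- Trivially ex ≤ n^r. For k ≤ r fix s larger than |V(F^r_{t,k})| and delete, in each
-- of 2r rounds, every edge having an (r-1)-subset of codegree < s; a round deletes at most s·n^(r-1)
-- edges. An edge surviving all rounds yields F^r_{t,k} greedily: walking down one round at a time, a
-- used vertex of the current edge can be exchanged for an unused one, because the remaining
-- (r-1)-set has codegree ≥ s. With the centre taken in a surviving edge, this finds the t copies of
-- K_k in edges r rounds down, and the r-2 new vertices of each expanded edge another r rounds down.

open import Defs
open import Data.Empty using (⊥)
open import Data.Fin using (Fin; zero; suc; toℕ; fromℕ<; inject≤; combine; remQuot; finToFun; funToFin)
  renaming (_≟_ to _≟ᶠ_; _<_ to _<ᶠ_; _<?_ to _<?ᶠ_)
open import Data.Fin.Properties
  using (toℕ-injective; toℕ-fromℕ<; toℕ-inject≤; toℕ-combine; toℕ<n; inject≤-injective; combine-injective;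
         remQuot-combine; funToFin-finToFin; pigeonhole)
  renaming (<⇒≢ to <ᶠ⇒≢)
open import Data.List using (List; []; _∷_; _++_; length; map; filter; concatMap; find; allFin; lookup; tabulate; head; drop)
open import Data.List.Properties
  using (length-filter; length-map; length-++; length-tabulate; map-∘; filter-accept; filter-all; filter-some)
open import Data.List.Membership.Propositional using (_∈_; _∉_; lose) renaming (find to find∈)
open import Data.List.Membership.Propositional.Properties
  using (∈-allFin; ∈-lookup; ∈-map⁺; ∈-map⁻; ∈-filter⁺; ∈-filter⁻; ∈-++⁺ˡ; ∈-++⁺ʳ; ∈-++⁻; ∈-concatMap⁺; ∈-concatMap⁻;
         ∈-tabulate⁺; ∈-tabulate⁻)
open import Data.List.Relation.Binary.Permutation.Propositional using (_↭_; ↭-refl; ↭-sym; ↭-trans; prep; swap)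
open import Data.List.Relation.Binary.Permutation.Propositional.Properties using (↭-length; ∈-resp-↭)
open import Data.List.Relation.Binary.Sublist.Propositional using ([]; _∷_; _∷ʳ_; ⊆-refl; ⊆-trans) renaming (_⊆_ to _⊑_)
open import Data.List.Relation.Binary.Sublist.Propositional.Properties
  using (All-resp-⊆; filter-⊆; length-mono-≤) renaming (filter⁺ to Sublist-filter⁺)
open import Data.List.Relation.Binary.Subset.Propositional using (_⊆_)
open import Data.List.Relation.Unary.All as All using (All; []; _∷_; all?)
open import Data.List.Relation.Unary.All.Properties
  using (anti-mono; all-filter; ¬All⇒Any¬; ¬Any⇒All¬)
  renaming (map⁺ to All-map⁺; filter⁺ to All-filter⁺; tabulate⁺ to All-tabulate⁺; tabulate⁻ to All-tabulate⁻)
open import Data.List.Relation.Unary.AllPairs as AllPairs using (AllPairs; []; _∷_)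
import Data.List.Relation.Unary.AllPairs.Properties as AllPairsₚ
open import Data.List.Relation.Unary.Any as Any using (Any; here; there; any?; index; satisfied)
open import Data.List.Relation.Unary.Any.Properties using (lookup-index)
open import Data.List.Relation.Unary.Unique.Propositional using (Unique)
import Data.List.Relation.Unary.Unique.Propositional.Properties as Uniqueₚ
open import Data.Maybe using (Maybe; just; nothing; maybe′; fromMaybe)
open import Data.Maybe.Properties using (just-injective) renaming (≡-dec to Maybe-≡-dec)
open import Data.Maybe.Relation.Unary.All as Maybe using (just; nothing)
open import Data.Nat using (ℕ; zero; suc; pred; _+_; _*_; _∸_; _^_; _%_; _≤_; _<_; _≤?_; _<?_; z≤n; s≤s; NonZero)
open import Data.Nat.DivMod using (_/_; m%n<n; [m+kn]%n≡m%n; m<n⇒m%n≡m; m≡m%n+[m/n]*n; m/n*n≤m; m≥n⇒m/n>0)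
open import Data.Nat.ListAction using (sum)
open import Data.Nat.Properties
open import Algebra.Properties.CommutativeSemigroup *-commutativeSemigroup using (interchange)
open import Data.Product using (Σ; _×_; _,_; ∃; proj₁; proj₂; uncurry)
open import Data.Sum using (_⊎_; inj₁; inj₂; [_,_]; [_,_]′)
open import Data.Sum.Properties using (inj₁-injective; inj₂-injective)
open import Function using (_∘_)
open import Function.Definitions using (Injective)
open import Level using (0ℓ)
open import Relation.Binary.PropositionalEquality using (_≡_; _≢_; refl; sym; trans; cong; cong₂; subst; module ≡-Reasoning)
open import Relation.Nullary using (¬_; yes; no; ¬?)
open import Relation.Nullary.Decidable using (_×-dec_; decidable-stable)
open import Relation.Nullary.Negation using (contradiction)
open import Relation.Unary using (Pred; Decidable)

module _ {A : Set} where

  remove : {x : A} {xs : List A} → x ∈ xs → List A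
  remove {xs = _ ∷ xs} (here _)  = xs
  remove {xs = y ∷ _}  (there p) = y ∷ remove p

  remove-⊆ : {x : A} {xs : List A} (p : x ∈ xs) → remove p ⊆ xs
  remove-⊆ (here _)  q         = there q
  remove-⊆ (there p) (here q)  = here q
  remove-⊆ (there p) (there q) = there (remove-⊆ p q)

  ∈-remove : {x y : A} {xs : List A} (p : x ∈ xs) → y ∈ xs → y ≡ x ⊎ y ∈ remove p
  ∈-remove (here refl) (here q)  = inj₁ q
  ∈-remove (here refl) (there q) = inj₂ q
  ∈-remove (there p)   (here q)  = inj₂ (here q)
  ∈-remove (there p)   (there q) with ∈-remove p q
  ... | inj₁ y≡x = inj₁ y≡x
  ... | inj₂ y∈  = inj₂ (there y∈)

  remove-↭ : {x : A} {xs : List A} (p : x ∈ xs) → xs ↭ x ∷ remove p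
  remove-↭ (here refl) = ↭-refl
  remove-↭ (there p)   = ↭-trans (prep _ (remove-↭ p)) (swap _ _ ↭-refl)

  Unique-remove : {x : A} {xs : List A} (p : x ∈ xs) → Unique xs → Unique (remove p)
  Unique-remove (here _)  (_ ∷ u)  = u
  Unique-remove (there p) (y∉ ∷ u) = anti-mono (remove-⊆ p) y∉ ∷ Unique-remove p u

  length-filter-remove : {P : Pred A 0ℓ} (P? : Decidable P) {x : A} {xs : List A} (p : x ∈ xs) → P x →
                         suc (length (filter P? (remove p))) ≡ length (filter P? xs)
  length-filter-remove P? (here refl) px = cong length (sym (filter-accept P? px))
  length-filter-remove P? {xs = y ∷ _} (there p) px with P? y
  ... | yes _ = cong suc (length-filter-remove P? p px)
  ... | no _  = length-filter-remove P? p px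

  private
    ⊆-remove : {x : A} {xs ys : List A} → All (x ≢_) xs → x ∷ xs ⊆ ys → (p : x ∈ ys) → xs ⊆ remove p
    ⊆-remove x∉xs sub p y∈xs with ∈-remove p (sub (there y∈xs))
    ... | inj₁ refl = contradiction refl (All.lookup x∉xs y∈xs)
    ... | inj₂ y∈   = y∈

  Unique-⊆⇒length≤ : {xs ys : List A} → Unique xs → xs ⊆ ys → length xs ≤ length ys
  Unique-⊆⇒length≤ {[]}     _        _   = z≤n
  Unique-⊆⇒length≤ {x ∷ xs} {ys} (x∉ ∷ u) sub = begin
    suc (length xs)                           ≤⟨ s≤s (Unique-⊆⇒length≤ u (⊆-remove x∉ sub x∈ys)) ⟩
    suc (length (remove x∈ys))                ≡⟨ ↭-length (remove-↭ x∈ys) ⟨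
    length ys                                 ∎
    where
    open ≤-Reasoning
    x∈ys : x ∈ ys
    x∈ys = sub (here refl)

  Unique-⊆-length≤⇒↭ : {xs ys : List A} → Unique xs → xs ⊆ ys → length ys ≤ length xs → xs ↭ ys
  Unique-⊆-length≤⇒↭ {[]} {[]} _ _ _ = ↭-refl
  Unique-⊆-length≤⇒↭ {x ∷ xs} {ys} (x∉ ∷ u) sub len =
    ↭-trans (prep x (Unique-⊆-length≤⇒↭ u (⊆-remove x∉ sub x∈ys) len′)) (↭-sym (remove-↭ x∈ys))
    where
    x∈ys : x ∈ ys
    x∈ys = sub (here refl)
    len′ : length (remove x∈ys) ≤ length xs
    len′ = ≤-pred (subst (_≤ suc (length xs)) (↭-length (remove-↭ x∈ys)) len)

  Unique-lookup-injective : {xs : List A} → Unique xs → ∀ {i j} → lookup xs i ≡ lookup xs j → i ≡ j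
  Unique-lookup-injective (_ ∷ _)  {zero}  {zero}  _  = refl
  Unique-lookup-injective (x∉ ∷ _) {zero}  {suc j} eq = contradiction eq (All.lookup x∉ (∈-lookup j))
  Unique-lookup-injective (x∉ ∷ _) {suc i} {zero}  eq = contradiction (sym eq) (All.lookup x∉ (∈-lookup i))
  Unique-lookup-injective (_ ∷ u)  {suc i} {suc j} eq = cong suc (Unique-lookup-injective u eq)

  deletions : List A → List (List A)
  deletions []       = []
  deletions (x ∷ xs) = xs ∷ map (x ∷_) (deletions xs)

  remove∈deletions : {x : A} {xs : List A} (p : x ∈ xs) → remove p ∈ deletions xs
  remove∈deletions (here refl) = here refl
  remove∈deletions (there p)   = there (∈-map⁺ _ (remove∈deletions p))

  ∈-deletions⁻ : {S xs : List A} → S ∈ deletions xs → ∃ λ x → Σ (x ∈ xs) λ p → S ≡ remove p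
  ∈-deletions⁻ {xs = x ∷ xs} (here refl) = x , here refl , refl
  ∈-deletions⁻ {xs = x ∷ xs} (there S∈) with ∈-map⁻ (x ∷_) S∈
  ... | S′ , S′∈ , refl with ∈-deletions⁻ S′∈
  ...   | y , p , refl = y , there p , refl

  ∈-deletions⇒⊆ : {S xs : List A} → S ∈ deletions xs → S ⊆ xs
  ∈-deletions⇒⊆ S∈ with ∈-deletions⁻ S∈
  ... | _ , p , refl = remove-⊆ p

  ∈-deletions⇒length : {S xs : List A} → S ∈ deletions xs → suc (length S) ≡ length xs
  ∈-deletions⇒length S∈ with ∈-deletions⁻ S∈
  ... | _ , p , refl = sym (↭-length (remove-↭ p))

  find-just : {P : Pred A 0ℓ} (P? : Decidable P) {xs : List A} → Any P xs →
              ∃ λ z → find P? xs ≡ just z × z ∈ xs × P z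
  find-just P? {x ∷ xs} any with P? x | any
  ... | yes px | _        = x , refl , here refl , px
  ... | no ¬px | here px  = contradiction px ¬px
  ... | no _   | there a  with find-just P? a
  ...   | z , eq , z∈ , pz = z , eq , there z∈ , pz

  length≤filter+filter∁ : {P : Pred A 0ℓ} (P? : Decidable P) (xs : List A) →
                          length xs ≤ length (filter P? xs) + length (filter (¬? ∘ P?) xs)
  length≤filter+filter∁ P? []       = z≤n
  length≤filter+filter∁ P? (x ∷ xs) with P? x
  ... | yes _ = s≤s (length≤filter+filter∁ P? xs)
  ... | no _  = ≤-trans (s≤s (length≤filter+filter∁ P? xs)) (≤-reflexive (sym (+-suc _ _)))

  ∀∉⇒length≡0 : {xs : List A} → (∀ {x} → x ∉ xs) → length xs ≡ 0
  ∀∉⇒length≡0 {[]}    _    = refl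
  ∀∉⇒length≡0 {_ ∷ _} none = contradiction (here refl) none

  AllPairs-resp-⊑ : {R : A → A → Set} {xs ys : List A} → xs ⊑ ys → AllPairs R ys → AllPairs R xs
  AllPairs-resp-⊑ []           []        = []
  AllPairs-resp-⊑ (_ ∷ʳ xs⊑)   (_ ∷ rys) = AllPairs-resp-⊑ xs⊑ rys
  AllPairs-resp-⊑ (refl ∷ xs⊑) (r ∷ rys) = All-resp-⊆ xs⊑ r ∷ AllPairs-resp-⊑ xs⊑ rys

module _ {A B : Set} where

  Unique-map : {g : A → B} {P : Pred A 0ℓ} {R : A → A → Set} {xs : List A} → All P xs → AllPairs R xs →
               (∀ {x y} → P x → P y → R x y → g x ≢ g y) → Unique (map g xs)
  Unique-map []        []        _   = []
  Unique-map (px ∷ ps) (rx ∷ rs) sep =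
    All-map⁺ (All.zipWith (λ (py , rxy) → sep px py rxy) (ps , rx)) ∷ Unique-map ps rs sep

  map-⊆ : {f : A → B} {xs : List A} {ys : List B} → (∀ x → f x ∈ ys) → map f xs ⊆ ys
  map-⊆ {f} {xs} f∈ y∈ with x , _ , refl ← ∈-map⁻ f {xs = xs} y∈ = f∈ x

  maybe′-injective : {f : A → B} {b : B} → Injective _≡_ _≡_ f → (∀ x → f x ≢ b) → Injective _≡_ _≡_ (maybe′ f b)
  maybe′-injective f-inj f≢b {just x}  {just y}  eq = cong just (f-inj eq)
  maybe′-injective f-inj f≢b {just x}  {nothing} eq = contradiction eq (f≢b x)
  maybe′-injective f-inj f≢b {nothing} {just y}  eq = contradiction (sym eq) (f≢b y)
  maybe′-injective f-inj f≢b {nothing} {nothing} eq = refl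

  [,]-injective : {C : Set} {f : A → C} {g : B → C} → Injective _≡_ _≡_ f → Injective _≡_ _≡_ g →
                  (∀ x y → f x ≢ g y) → Injective _≡_ _≡_ [ f , g ]
  [,]-injective f-inj g-inj f≢g {inj₁ x} {inj₁ y} eq = cong inj₁ (f-inj eq)
  [,]-injective f-inj g-inj f≢g {inj₁ x} {inj₂ y} eq = contradiction eq (f≢g x y)
  [,]-injective f-inj g-inj f≢g {inj₂ x} {inj₁ y} eq = contradiction (sym eq) (f≢g y x)
  [,]-injective f-inj g-inj f≢g {inj₂ x} {inj₂ y} eq = cong inj₂ (g-inj eq)

module _ {B : Set} (f g : B → ℕ) where

  sum-map-mono-≤ : (∀ b → f b ≤ g b) → (bs : List B) → sum (map f bs) ≤ sum (map g bs)
  sum-map-mono-≤ f≤g []       = z≤n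
  sum-map-mono-≤ f≤g (b ∷ bs) = +-mono-≤ (f≤g b) (sum-map-mono-≤ f≤g bs)

  sum-map-mono-< : (∀ b → f b ≤ g b) → {b : B} {bs : List B} → b ∈ bs → f b < g b →
                   sum (map f bs) < sum (map g bs)
  sum-map-mono-< f≤g {bs = _ ∷ bs} (here refl) fb<gb = +-mono-<-≤ fb<gb (sum-map-mono-≤ f≤g bs)
  sum-map-mono-< f≤g {bs = c ∷ _}  (there b∈)  fb<gb = +-mono-≤-< (f≤g c) (sum-map-mono-< f≤g b∈ fb<gb)

sum-map-const : {B : Set} (c : ℕ) (bs : List B) → sum (map (λ _ → c) bs) ≡ length bs * c
sum-map-const c []       = refl
sum-map-const c (_ ∷ bs) = cong (c +_) (sum-map-const c bs)

module _ {A : Set} where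

  length-filter-∷ : {P : Pred A 0ℓ} (P? : Decidable P) (x : A) (xs : List A) →
                    length (filter P? xs) ≤ length (filter P? (x ∷ xs))
  length-filter-∷ P? x xs with P? x
  ... | yes _ = n≤1+n _
  ... | no _  = ≤-refl

  length≤∑-classes : {n : ℕ} {P : Fin n → Pred A 0ℓ} (P? : ∀ a → Decidable (P a)) {xs : List A} →
                     All (λ x → ∃ λ a → P a x) xs →
                     length xs ≤ sum (map (λ a → length (filter (P? a) xs)) (allFin n))
  length≤∑-classes P? []                              = z≤n
  length≤∑-classes {n} P? {x ∷ xs} ((b , pbx) ∷ classes) = begin-strict
    length xs
      ≤⟨ length≤∑-classes P? classes ⟩
    sum (map (λ a → length (filter (P? a) xs)) (allFin n))
      <⟨ sum-map-mono-< _ _ (λ a → length-filter-∷ (P? a) x xs) (∈-allFin b) new ⟩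
    sum (map (λ a → length (filter (P? a) (x ∷ xs))) (allFin n)) ∎
    where
    open ≤-Reasoning
    new : length (filter (P? b) xs) < length (filter (P? b) (x ∷ xs))
    new = ≤-reflexive (cong length (sym (filter-accept (P? b) pbx)))

  length≤-by-keys : {n : ℕ} (b m : ℕ) (key : A → List (Fin n)) {xs : List A} →
                    All (λ x → length (key x) ≡ m) xs →
                    (∀ {L zs} → zs ⊑ xs → All (λ z → key z ≡ L) zs → length zs ≤ b) →
                    length xs ≤ b * n ^ m
  length≤-by-keys {n} b zero key {xs} lengths fibre = begin
    length xs ≤⟨ fibre ⊆-refl (All.map length≡0⇒[] lengths) ⟩
    b         ≡⟨ *-identityʳ b ⟨
    b * 1     ∎
    where
    open ≤-Reasoning
    length≡0⇒[] : {L : List (Fin n)} → length L ≡ 0 → L ≡ []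
    length≡0⇒[] {[]} _ = refl
  length≤-by-keys {n} b (suc m) key {xs} lengths fibre = begin
    length xs                                     ≤⟨ length≤∑-classes startsWith? (All.map (λ {x} → nonempty (key x)) lengths) ⟩
    sum (map (λ a → length (class a)) (allFin n)) ≤⟨ sum-map-mono-≤ _ _ class≤ (allFin n) ⟩
    sum (map (λ _ → b * n ^ m) (allFin n))        ≡⟨ sum-map-const _ (allFin n) ⟩
    length (allFin n) * (b * n ^ m)               ≡⟨ cong (_* (b * n ^ m)) (length-tabulate {n = n} (λ a → a)) ⟩
    n * (b * n ^ m)                               ≡⟨ *-assoc n b (n ^ m) ⟨
    n * b * n ^ m                                 ≡⟨ cong (_* n ^ m) (*-comm n b) ⟩
    b * n * n ^ m                                 ≡⟨ *-assoc b n (n ^ m) ⟩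
    b * n ^ suc m                                 ∎
    where
    open ≤-Reasoning
    startsWith? : ∀ a → Decidable (λ x → head (key x) ≡ just a)
    startsWith? a x = Maybe-≡-dec _≟ᶠ_ (head (key x)) (just a)
    nonempty : (L : List (Fin n)) → length L ≡ suc m → ∃ λ a → head L ≡ just a
    nonempty (a ∷ _) _ = a , refl
    unhead : {a : Fin n} (L : List (Fin n)) → head L ≡ just a → L ≡ a ∷ drop 1 L
    unhead (_ ∷ _) refl = refl
    drop-length : (L : List (Fin n)) → length L ≡ suc m → length (drop 1 L) ≡ m
    drop-length (_ ∷ _) = suc-injective
    class : Fin n → List A
    class a = filter (startsWith? a) xs
    class≤ : ∀ a → length (class a) ≤ b * n ^ m
    class≤ a = length≤-by-keys b m (drop 1 ∘ key)
      (All-filter⁺ (startsWith? a) (All.map (λ {x} → drop-length (key x)) lengths))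
      λ zs⊑ tails → fibre (⊆-trans zs⊑ (filter-⊆ (startsWith? a) xs))
        (All.zipWith (λ (starts , tail) → trans (unhead (key _) starts) (cong (a ∷_) tail))
                     (All-resp-⊆ zs⊑ (all-filter (startsWith? a) xs) , tails))

-- Codegrees in r-graphs

module _ {n : ℕ} where

  open import Data.List.Membership.DecPropositional (_≟ᶠ_ {n}) using (_∈?_; _∉?_)
  open import Data.List.Relation.Binary.Subset.DecPropositional (_≟ᶠ_ {n}) using (_⊆?_)

  Edge : ℕ → List (Fin n) → Set
  Edge r e = length e ≡ r × Unique e

  Simple : List (List (Fin n)) → Set
  Simple = AllPairs (λ e f → ¬ (e ↭ f))

  codegree : List (List (Fin n)) → List (Fin n) → ℕ
  codegree G S = length (filter (S ⊆?_) G)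

  Clash : List (Fin n) → List (Fin n) → Pred (Fin n) 0ℓ
  Clash K U z = z ∈ U × z ∉ K

  clash? : (K U : List (Fin n)) → Decidable (Clash K U)
  clash? K U z = (z ∈? U) ×-dec (z ∉? K)

  Avoids : List (Fin n) → List (Fin n) → List (Fin n) → Set
  Avoids K U f = ∀ {z} → z ∈ f → z ∈ U → z ∈ K

  ¬Any-Clash⇒Avoids : {K U f : List (Fin n)} → ¬ Any (Clash K U) f → Avoids K U f
  ¬Any-Clash⇒Avoids {K} none {z} z∈f z∈U with z ∈? K
  ... | yes z∈K = z∈K
  ... | no  z∉K = contradiction (lose z∈f (z∈U , z∉K)) none

  -- The first clashing vertex of each such edge determines it, as the edge is S plus that vertex.
  clashing-extensions≤ : {r : ℕ} {C : List (List (Fin n))} {S U : List (Fin n)} →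
                         All (Edge r) C → Simple C → Unique S → suc (length S) ≡ r →
                         All (λ f → S ⊆ f × Any (Clash S U) f) C → length C ≤ length U
  clashing-extensions≤ {r} {C} {S} {U} uniform simple S-unique |S|+1≡r extensions = begin
    length C               ≡⟨ length-map apex C ⟨
    length (map apex C)    ≤⟨ Unique-⊆⇒length≤ (Unique-map (All.tabulate (λ f∈ → f∈)) simple apex-separates) apex∈U ⟩
    length (map just U)    ≡⟨ length-map just U ⟩
    length U               ∎
    where
    open ≤-Reasoning
    apex : List (Fin n) → Maybe (Fin n)
    apex = find (clash? S U)
    apex-↭ : ∀ {f z} → f ∈ C → apex f ≡ just z → z ∷ S ↭ f
    apex-↭ {f} f∈ apex≡z with z , eq , z∈f , (_ , z∉S) ← find-just (clash? S U) (proj₂ (All.lookup extensions f∈))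
      with refl ← just-injective (trans (sym eq) apex≡z) =
      Unique-⊆-length≤⇒↭ (¬Any⇒All¬ S z∉S ∷ S-unique) z∷S⊆f
        (≤-reflexive (trans (proj₁ (All.lookup uniform f∈)) (sym |S|+1≡r)))
      where
      z∷S⊆f : z ∷ S ⊆ f
      z∷S⊆f (here refl) = z∈f
      z∷S⊆f (there y∈S) = proj₁ (All.lookup extensions f∈) y∈S
    apex-separates : ∀ {f f′} → f ∈ C → f′ ∈ C → ¬ (f ↭ f′) → apex f ≢ apex f′
    apex-separates f∈ f′∈ f≁f′ eq with z , apex≡z , _ ← find-just (clash? S U) (proj₂ (All.lookup extensions f∈)) =
      f≁f′ (↭-trans (↭-sym (apex-↭ f∈ apex≡z)) (apex-↭ f′∈ (trans (sym eq) apex≡z)))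
    apex∈U : map apex C ⊆ map just U
    apex∈U a∈ with f , f∈ , refl ← ∈-map⁻ apex a∈
      with z , apex≡z , _ , (z∈U , _) ← find-just (clash? S U) (proj₂ (All.lookup extensions f∈)) =
      subst (_∈ map just U) (sym apex≡z) (∈-map⁺ just z∈U)

  avoiding-extension : {r : ℕ} {G : List (List (Fin n))} → All (Edge r) G → Simple G →
                       {S U : List (Fin n)} → Unique S → suc (length S) ≡ r → length U < codegree G S →
                       ∃ λ f → f ∈ G × S ⊆ f × Avoids S U f
  avoiding-extension {G = G} uniform simple {S} {U} S-unique |S|+1≡r U<codeg
    with any? (λ f → ¬? (any? (clash? S U) f)) (filter (S ⊆?_) G)
  ... | yes some with f , f∈ , none ← find∈ some with f∈G , S⊆f ← ∈-filter⁻ (S ⊆?_) {xs = G} f∈ =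
    f , f∈G , S⊆f , ¬Any-Clash⇒Avoids none
  ... | no none = contradiction
    (clashing-extensions≤ (All-filter⁺ (S ⊆?_) uniform) (AllPairsₚ.filter⁺ (S ⊆?_) simple) S-unique |S|+1≡r
      (All.tabulate λ f∈ → proj₂ (∈-filter⁻ (S ⊆?_) {xs = G} f∈) ,
                           decidable-stable (any? (clash? S U) _) (λ ¬any → none (lose f∈ ¬any))))
    (<⇒≱ U<codeg)

  choose-outside : (q : ℕ) {f K : List (Fin n)} → Unique f → q + length K ≤ length f →
                   ∃ λ (X : Fin q → Fin n) → Injective _≡_ _≡_ X × (∀ a → X a ∈ f × X a ∉ K)
  choose-outside q {f} {K} f-unique room =
    X , (λ eq → inject≤-injective q≤ q≤ _ _ (Unique-lookup-injective outside-unique eq)) ,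
    (λ a → ∈-filter⁻ (_∉? K) {xs = f} (∈-lookup (inject≤ a q≤)))
    where
    outside : List (Fin n)
    outside = filter (_∉? K) f
    outside-unique : Unique outside
    outside-unique = Uniqueₚ.filter⁺ (_∉? K) f-unique
    inside≤ : length (filter (_∈? K) f) ≤ length K
    inside≤ = Unique-⊆⇒length≤ (Uniqueₚ.filter⁺ (_∈? K) f-unique) (proj₂ ∘ ∈-filter⁻ (_∈? K) {xs = f})
    q≤ : q ≤ length outside
    q≤ = +-cancelʳ-≤ (length K) q (length outside) (begin
      q + length K                                ≤⟨ room ⟩
      length f                                    ≤⟨ length≤filter+filter∁ (_∈? K) f ⟩
      length (filter (_∈? K) f) + length outside  ≤⟨ +-monoˡ-≤ (length outside) inside≤ ⟩
      length K + length outside                   ≡⟨ +-comm (length K) (length outside) ⟩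
      length outside + length K                   ∎)
      where open ≤-Reasoning
    X : Fin q → Fin n
    X a = lookup outside (inject≤ a q≤)

∣E∣≤n^r : ∀ {r n} (H : RGraph r n) → ∣E∣ H ≤ 1 * n ^ r
∣E∣≤n^r {r} H = length≤-by-keys 1 r (λ e → e) (All.map proj₁ (uniform H)) at-most-one
  where
  at-most-one : ∀ {L zs} → zs ⊑ edges H → All (_≡ L) zs → length zs ≤ 1
  at-most-one {zs = []}        _ _ = z≤n
  at-most-one {zs = _ ∷ []}    _ _ = ≤-refl
  at-most-one {zs = _ ∷ _ ∷ _} zs⊑ (refl ∷ refl ∷ _) with (z≁z′ ∷ _) ∷ _ ← AllPairs-resp-⊑ zs⊑ (simple H) =
    contradiction ↭-refl z≁z′

-- Peeling off edges with a low-codegree (r−1)-subset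

module Peeling (r s : ℕ) {n : ℕ} (H : RGraph r n) where

  open import Data.List.Relation.Binary.Subset.DecPropositional (_≟ᶠ_ {n}) using (_⊆?_)

  Good : List (List (Fin n)) → List (Fin n) → Set
  Good G e = All (λ S → s ≤ codegree G S) (deletions e)

  good? : (G : List (List (Fin n))) → Decidable (Good G)
  good? G e = all? (λ S → s ≤? codegree G S) (deletions e)

  -- `[]` is a junk value: an edge that is not Good has a low deletion.
  lowDeletion : List (List (Fin n)) → List (Fin n) → List (Fin n)
  lowDeletion G e = fromMaybe [] (find (λ S → codegree G S <? s) (deletions e))

  lowDeletion-spec : ∀ {G e} → ¬ Good G e → lowDeletion G e ∈ deletions e × codegree G (lowDeletion G e) < s
  lowDeletion-spec {G} {e} bad
    with S , found , S∈ , low ← find-just (λ S → codegree G S <? s) (Any.map ≰⇒> (¬All⇒Any¬ (λ S → s ≤? codegree G S) _ bad))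
    rewrite found = S∈ , low

  -- A bad edge is keyed by its first low deletion; the edges sharing the key L contain L,
  -- so there are fewer than s of them.
  length-bad≤ : ∀ {G} → All (Edge r) G → length (filter (¬? ∘ good? G) G) ≤ s * n ^ (r ∸ 1)
  length-bad≤ {G} uniform = length≤-by-keys s (r ∸ 1) (lowDeletion G) (All.tabulate lowDeletion-length) fibre
    where
    Bad : List (List (Fin n))
    Bad = filter (¬? ∘ good? G) G
    ∈Bad⇒ : ∀ {e} → e ∈ Bad → e ∈ G × ¬ Good G e
    ∈Bad⇒ = ∈-filter⁻ (¬? ∘ good? G) {xs = G}
    lowDeletion-length : ∀ {e} → e ∈ Bad → length (lowDeletion G e) ≡ r ∸ 1
    lowDeletion-length {e} e∈ = begin-equality
      length (lowDeletion G e)  ≡⟨ cong pred (∈-deletions⇒length (proj₁ (lowDeletion-spec {G} (proj₂ (∈Bad⇒ e∈))))) ⟩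
      pred (length e)           ≡⟨ cong pred (proj₁ (All.lookup uniform (proj₁ (∈Bad⇒ e∈)))) ⟩
      pred r                    ≡⟨ pred[m∸n]≡m∸[1+n] r 0 ⟩
      r ∸ 1                     ∎
      where open ≤-Reasoning
    contains-key : ∀ {e L} → e ∈ Bad × lowDeletion G e ≡ L → L ⊆ e
    contains-key (e∈ , refl) = ∈-deletions⇒⊆ (proj₁ (lowDeletion-spec {G} (proj₂ (∈Bad⇒ e∈))))
    fibre : ∀ {L zs} → zs ⊑ Bad → All (λ z → lowDeletion G z ≡ L) zs → length zs ≤ s
    fibre {zs = []}         _   _               = z≤n
    fibre {L} {z ∷ zs} zs⊑ keys@(refl ∷ _) = <⇒≤ (≤-<-trans zs≤codeg (proj₂ (lowDeletion-spec {G} (proj₂ (∈Bad⇒ z∈)))))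
      where
      z∈ : z ∈ Bad
      z∈ = All.head (All-resp-⊆ zs⊑ (All.tabulate (λ e∈ → e∈)))
      contains : All (L ⊆_) (z ∷ zs)
      contains = All.zipWith contains-key (All-resp-⊆ zs⊑ (All.tabulate (λ e∈ → e∈)) , keys)
      zs≤codeg : length (z ∷ zs) ≤ codegree G L
      zs≤codeg = subst (λ ys → length ys ≤ codegree G L) (filter-all (L ⊆?_) contains)
        (length-mono-≤ (Sublist-filter⁺ (L ⊆?_) (L ⊆?_) (λ { refl p → p }) (⊆-trans zs⊑ (filter-⊆ (¬? ∘ good? G) G))))

  level : ℕ → List (List (Fin n))
  level zero    = edges H
  level (suc j) = filter (good? (level j)) (level j)

  level-uniform : ∀ j → All (Edge r) (level j)
  level-uniform zero    = uniform H
  level-uniform (suc j) = All-filter⁺ (good? (level j)) (level-uniform j)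

  level-simple : ∀ j → Simple (level j)
  level-simple zero    = simple H
  level-simple (suc j) = AllPairsₚ.filter⁺ (good? (level j)) (level-simple j)

  ∈-level-suc : ∀ {j e} → e ∈ level (suc j) → e ∈ level j × Good (level j) e
  ∈-level-suc {j} = ∈-filter⁻ (good? (level j)) {xs = level j}

  ∈-level-+ : ∀ m {j e} → e ∈ level (m + j) → e ∈ level j
  ∈-level-+ zero        e∈ = e∈
  ∈-level-+ (suc m) {j} e∈ = ∈-level-+ m (proj₁ (∈-level-suc {m + j} e∈))

  length-level≤ : ∀ j → length (level j) ≤ length (level (suc j)) + s * n ^ (r ∸ 1)
  length-level≤ j = ≤-trans (length≤filter+filter∁ (good? (level j)) (level j))
                            (+-monoʳ-≤ (length (level (suc j))) (length-bad≤ (level-uniform j)))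

  ∣E∣≤∣level∣+ : ∀ d → ∣E∣ H ≤ length (level d) + d * (s * n ^ (r ∸ 1))
  ∣E∣≤∣level∣+ zero    = ≤-reflexive (sym (+-identityʳ (∣E∣ H)))
  ∣E∣≤∣level∣+ (suc d) = begin
    ∣E∣ H                                     ≤⟨ ∣E∣≤∣level∣+ d ⟩
    length (level d) + d * loss               ≤⟨ +-monoˡ-≤ (d * loss) (length-level≤ d) ⟩
    length (level (suc d)) + loss + d * loss  ≡⟨ +-assoc (length (level (suc d))) loss (d * loss) ⟩
    length (level (suc d)) + suc d * loss     ∎
    where
    open ≤-Reasoning
    loss : ℕ
    loss = s * n ^ (r ∸ 1)

  -- The clashing vertex y is exchanged for a vertex outside U: the rest of e has codegree ≥ s > |U| one level down.
  exchange-clash : ∀ {j e K U y} → e ∈ level (suc j) → K ⊆ e → length U < s → (y∈e : y ∈ e) → Clash K U y →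
                   ∃ λ f → f ∈ level j × K ⊆ f × length (filter (clash? K U) f) < length (filter (clash? K U) e)
  exchange-clash {j} {e} {K} {U} e∈ K⊆e U<s y∈e clash@(_ , y∉K) =
    exchange (avoiding-extension (level-uniform j) (level-simple j) (Unique-remove y∈e (proj₂ e-edge))
                                 (trans (∈-deletions⇒length (remove∈deletions y∈e)) (proj₁ e-edge))
                                 (≤-trans U<s (All.lookup (proj₂ (∈-level-suc {j} e∈)) (remove∈deletions y∈e))))
    where
    open ≤-Reasoning
    e-edge : Edge r e
    e-edge = All.lookup (level-uniform (suc j)) e∈
    exchange : (∃ λ f → f ∈ level j × remove y∈e ⊆ f × Avoids (remove y∈e) U f) →
               ∃ λ f → f ∈ level j × K ⊆ f × length (filter (clash? K U) f) < length (filter (clash? K U) e)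
    exchange (f , f∈ , S⊆f , avoids) = f , f∈ , K⊆f , (begin-strict
      length (filter (clash? K U) f)
        ≤⟨ Unique-⊆⇒length≤ (Uniqueₚ.filter⁺ (clash? K U) (proj₂ (All.lookup (level-uniform j) f∈))) clashes⊆ ⟩
      length (filter (clash? K U) (remove y∈e))
        <⟨ ≤-reflexive (length-filter-remove (clash? K U) y∈e clash) ⟩
      length (filter (clash? K U) e)             ∎)
      where
      K⊆f : K ⊆ f
      K⊆f k∈K with ∈-remove y∈e (K⊆e k∈K)
      ... | inj₁ refl = contradiction k∈K y∉K
      ... | inj₂ k∈S  = S⊆f k∈S
      clashes⊆ : filter (clash? K U) f ⊆ filter (clash? K U) (remove y∈e)
      clashes⊆ z∈ with z∈f , c@(z∈U , _) ← ∈-filter⁻ (clash? K U) {xs = f} z∈ =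
        ∈-filter⁺ (clash? K U) (avoids z∈f z∈U) c

  avoiding-descent : ∀ m {j e K U} → e ∈ level (m + j) → K ⊆ e → length U < s →
                     length (filter (clash? K U) e) ≤ m → ∃ λ f → f ∈ level j × K ⊆ f × Avoids K U f
  avoiding-descent m {e = e} {K} {U} e∈ K⊆e U<s clashes≤m with any? (clash? K U) e
  ... | no none = e , ∈-level-+ m e∈ , K⊆e , ¬Any-Clash⇒Avoids none
  avoiding-descent zero    _  _   _   clashes≤0 | yes some = contradiction clashes≤0 (<⇒≱ (filter-some _ some))
  avoiding-descent (suc m) {j} e∈ K⊆e U<s clashes≤m | yes some
    with y , y∈e , clash ← find∈ some
    with f , f∈ , K⊆f , fewer ← exchange-clash {m + j} e∈ K⊆e U<s y∈e clash
    = avoiding-descent m f∈ K⊆f U<s (≤-pred (≤-trans fewer clashes≤m))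

  record Blocks (M q j : ℕ) (K : Fin M → List (Fin n)) (U : List (Fin n)) : Set where
    field
      block           : Fin M → Fin q → Fin n
      block-injective : Injective _≡_ _≡_ (uncurry block)
      block-∉U        : ∀ i a → block i a ∉ U
      block-∉K        : ∀ i a → block i a ∉ K i
      block-edge      : ∀ i → ∃ λ f → f ∈ level j × K i ⊆ f × (∀ a → block i a ∈ f)

  cons-block : ∀ {M q j K U} (X : Fin q → Fin n) → Injective _≡_ _≡_ X → (∀ a → X a ∉ U) → (∀ a → X a ∉ K zero) →
               (∃ λ f → f ∈ level j × K zero ⊆ f × (∀ a → X a ∈ f)) →
               Blocks M q j (K ∘ suc) (map X (allFin q) ++ U) → Blocks (suc M) q j K U
  cons-block {M} {q} {j} {K} {U} X X-injective X∉U X∉K X-edge rest = record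
    { block = block ; block-injective = injective ; block-∉U = ∉U ; block-∉K = ∉K ; block-edge = edge }
    where
    module R = Blocks rest
    X∈U′ : ∀ a → X a ∈ map X (allFin q) ++ U
    X∈U′ a = ∈-++⁺ˡ (∈-map⁺ X (∈-allFin a))
    block : Fin (suc M) → Fin q → Fin n
    block zero    = X
    block (suc i) = R.block i
    injective : Injective _≡_ _≡_ (uncurry block)
    injective {zero  , a} {zero   , b} eq = cong (zero ,_) (X-injective eq)
    injective {zero  , a} {suc i  , b} eq = contradiction (subst (_∈ _) eq (X∈U′ a)) (R.block-∉U i b)
    injective {suc i , a} {zero   , b} eq = contradiction (subst (_∈ _) (sym eq) (X∈U′ b)) (R.block-∉U i a)
    injective {suc i , a} {suc i′ , b} eq with refl ← R.block-injective {i , a} {i′ , b} eq = refl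
    ∉U : ∀ i a → block i a ∉ U
    ∉U zero      = X∉U
    ∉U (suc i) a = R.block-∉U i a ∘ ∈-++⁺ʳ _
    ∉K : ∀ i a → block i a ∉ K i
    ∉K zero    = X∉K
    ∉K (suc i) = R.block-∉K i
    edge : ∀ i → ∃ λ f → f ∈ level j × K i ⊆ f × (∀ a → block i a ∈ f)
    edge zero    = X-edge
    edge (suc i) = R.block-edge i

  -- Stated for level (j + r) so that j = 0 gives level r on the nose.
  blocks : ∀ M q j (K : Fin M → List (Fin n)) (U : List (Fin n)) →
           (∀ i → ∃ λ e → e ∈ level (j + r) × K i ⊆ e) → (∀ i → q + length (K i) ≤ r) →
           length U + M * q < s → Blocks M q j K U
  blocks zero q j K U _ _ _ = record
    { block = λ () ; block-injective = λ { {() , _} } ; block-∉U = λ () ; block-∉K = λ () ; block-edge = λ () }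
  blocks (suc M) q j K U base room budget
    with e , e∈ , K⊆e ← base zero
    with f , f∈ , K⊆f , avoids ← avoiding-descent r (subst (λ i → e ∈ level i) (+-comm j r) e∈) K⊆e
           (≤-<-trans (m≤m+n (length U) (suc M * q)) budget)
           (≤-trans (length-filter _ e) (≤-reflexive (proj₁ (All.lookup (level-uniform (j + r)) e∈))))
    with X , X-injective , X∈f∖K ← choose-outside q (proj₂ (All.lookup (level-uniform j) f∈))
           (subst (q + length (K zero) ≤_) (sym (proj₁ (All.lookup (level-uniform j) f∈))) (room zero))
    = cons-block X X-injective (λ a Xa∈U → proj₂ (X∈f∖K a) (avoids (proj₁ (X∈f∖K a)) Xa∈U)) (proj₂ ∘ X∈f∖K)
        (f , f∈ , K⊆f , proj₁ ∘ X∈f∖K)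
        (blocks M q j (K ∘ suc) (map X (allFin q) ++ U) (base ∘ suc) (room ∘ suc) (subst (_< s) used budget))
    where
    used : length U + suc M * q ≡ length (map X (allFin q) ++ U) + M * q
    used = begin-equality
      length U + (q + M * q)                       ≡⟨ +-assoc (length U) q (M * q) ⟨
      length U + q + M * q                         ≡⟨ cong (_+ M * q) (+-comm (length U) q) ⟩
      q + length U + M * q                         ≡⟨ cong (λ l → l + length U + M * q) (length-tabulate {n = q} (λ a → a)) ⟨
      length (allFin q) + length U + M * q         ≡⟨ cong (λ l → l + length U + M * q) (length-map X (allFin q)) ⟨
      length (map X (allFin q)) + length U + M * q ≡⟨ cong (_+ M * q) (length-++ (map X (allFin q))) ⟨
      length (map X (allFin q) ++ U) + M * q       ∎
      where open ≤-Reasoning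

-- The expanded fan

-- `expansion r E` unfolds to `tabulate (expansionEdge r E)`.
expansionEdge : {V : Set} (r : ℕ) (E : List (V × V)) → Fin (length E) → List (ExpVertex V (length E) r)
expansionEdge r E i = inj₁ (proj₁ (lookup E i)) ∷ inj₁ (proj₂ (lookup E i)) ∷ map (λ j → inj₂ (i , j)) (allFin (r ∸ 2))

-- `fanEdges t k` unfolds to `concatMap (fanCopy t k) (allFin t)`.
fanCopy : (t k : ℕ) → Fin t → List (FanVertex t k × FanVertex t k)
fanCopy t k a =
  map (λ i → (nothing , just (a , i))) (allFin (k ∸ 1)) ++
  concatMap (λ i → map (λ j → (just (a , i) , just (a , j))) (filter (i <?ᶠ_) (allFin (k ∸ 1)))) (allFin (k ∸ 1))

-- The centre `nothing` lies in every copy.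
InCopy : {A B : Set} → A → Maybe (A × B) → Set
InCopy a = Maybe.All ((_≡ a) ∘ proj₁)

fan-edge-in-copy : ∀ {t k u w} → (u , w) ∈ fanEdges t k → u ≢ w × ∃ λ a → InCopy a u × InCopy a w
fan-edge-in-copy {t} {k} e∈ with a , e∈copy ← satisfied (∈-concatMap⁻ (fanCopy t k) {xs = allFin t} e∈)
  with ∈-++⁻ (map (λ i → (nothing , just (a , i))) (allFin (k ∸ 1))) e∈copy
... | inj₁ spoke with _ , _ , refl ← ∈-map⁻ _ spoke = (λ ()) , a , nothing , just refl
... | inj₂ rim with i , e∈i ← satisfied (∈-concatMap⁻ _ {xs = allFin (k ∸ 1)} rim)
  with j , j∈ , refl ← ∈-map⁻ _ e∈i =
    (λ eq → <ᶠ⇒≢ (proj₂ (∈-filter⁻ (i <?ᶠ_) {xs = allFin (k ∸ 1)} j∈)) (cong proj₂ (just-injective eq))) ,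
    a , just refl , just refl

fanClique : ∀ {t k} → Fin (suc k) → FanVertex (suc t) (suc k)
fanClique zero    = nothing
fanClique (suc i) = just (zero , i)

fanClique-injective : ∀ {t k} → Injective _≡_ _≡_ (fanClique {t} {k})
fanClique-injective {x = zero}  {zero}  _    = refl
fanClique-injective {x = suc i} {suc j} refl = refl

fanClique-adjacent : ∀ {t k} {i j : Fin (suc k)} → i <ᶠ j → (fanClique i , fanClique j) ∈ fanEdges (suc t) (suc k)
fanClique-adjacent {t} {k} {zero}  {suc j} _ =
  ∈-concatMap⁺ (fanCopy (suc t) (suc k)) {xs = allFin (suc t)} (here (∈-++⁺ˡ (∈-map⁺ _ (∈-allFin j))))
fanClique-adjacent {t} {k} {suc i} {suc j} (s≤s i<j) =
  ∈-concatMap⁺ (fanCopy (suc t) (suc k)) {xs = allFin (suc t)} (here (∈-++⁺ʳ _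
    (∈-concatMap⁺ _ {xs = allFin k} (lose (∈-allFin i) (∈-map⁺ _ (∈-filter⁺ (i <?ᶠ_) (∈-allFin j) i<j))))))

-- One more than the number of vertices of the expanded fan.
fanThreshold : (r t k : ℕ) → ℕ
fanThreshold r t k = 2 + t * (k ∸ 1) + length (fanEdges t k) * (r ∸ 2)

module FanEmbedding {r t k : ℕ} (2≤r : 2 ≤ r) (1≤k : 1 ≤ k) (k≤r : k ≤ r) {n : ℕ} (H : RGraph r n) where

  open Peeling r (fanThreshold r t k) H

  module _ {c : Fin n} {rest : List (Fin n)} (survivor : c ∷ rest ∈ level (r + r)) where

    copies : Blocks t (k ∸ 1) r (λ _ → c ∷ []) (c ∷ [])
    copies = blocks t (k ∸ 1) r _ _ (λ _ → _ , survivor , λ { (here refl) → here refl })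
                    (λ _ → ≤-trans (≤-reflexive (m∸n+n≡m 1≤k)) k≤r) (s≤s (s≤s (m≤m+n _ _)))

    module C = Blocks copies

    ψ : FanVertex t k → Fin n
    ψ = maybe′ (uncurry C.block) c

    ψ-injective : Injective _≡_ _≡_ ψ
    ψ-injective = maybe′-injective C.block-injective (λ (a , i) eq → C.block-∉U a i (here eq))

    copy-edge : ∀ a → ∃ λ f → f ∈ level r × (∀ {v} → InCopy a v → ψ v ∈ f)
    copy-edge a with f , f∈ , c∈f , block∈f ← C.block-edge a = f , f∈ , λ where
      nothing     → c∈f (here refl)
      (just refl) → block∈f _

    ψ-image : List (Fin n)
    ψ-image = c ∷ map (uncurry C.block ∘ remQuot (k ∸ 1)) (allFin (t * (k ∸ 1)))

    ψ∈ψ-image : ∀ v → ψ v ∈ ψ-image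
    ψ∈ψ-image nothing        = here refl
    ψ∈ψ-image (just (a , i)) = there (subst (λ x → uncurry C.block x ∈ _) (remQuot-combine a i)
                                         (∈-map⁺ (uncurry C.block ∘ remQuot (k ∸ 1)) (∈-allFin (combine a i))))

    length-ψ-image : length ψ-image ≡ suc (t * (k ∸ 1))
    length-ψ-image = cong suc (trans (length-map _ (allFin (t * (k ∸ 1))))
                                     (length-tabulate {n = t * (k ∸ 1)} (λ x → x)))

    ends : Fin (length (fanEdges t k)) → List (Fin n)
    ends i = ψ (proj₁ (lookup (fanEdges t k) i)) ∷ ψ (proj₂ (lookup (fanEdges t k) i)) ∷ []

    ends-in-edge : ∀ i → ∃ λ f → f ∈ level r × ends i ⊆ f
    ends-in-edge i with _ , a , u-in , w-in ← fan-edge-in-copy {t} {k} (∈-lookup {xs = fanEdges t k} i)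
      with f , f∈ , ψ∈f ← copy-edge a = f , f∈ , λ where
        (here refl)         → ψ∈f u-in
        (there (here refl)) → ψ∈f w-in

    ends-unique : ∀ i → Unique (ends i)
    ends-unique i = (ψu≢ψw ∷ []) ∷ [] ∷ []
      where
      ψu≢ψw : ψ (proj₁ (lookup (fanEdges t k) i)) ≢ ψ (proj₂ (lookup (fanEdges t k) i))
      ψu≢ψw = proj₁ (fan-edge-in-copy {t} {k} (∈-lookup {xs = fanEdges t k} i)) ∘ ψ-injective

    expansions : Blocks (length (fanEdges t k)) (r ∸ 2) 0 ends ψ-image
    expansions = blocks _ (r ∸ 2) 0 ends ψ-image ends-in-edge (λ _ → ≤-reflexive (m∸n+n≡m 2≤r))
                        (subst (λ l → l + length (fanEdges t k) * (r ∸ 2) < fanThreshold r t k)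
                               (sym length-ψ-image) ≤-refl)

    module X = Blocks expansions

    φ : ExpVertex (FanVertex t k) (length (fanEdges t k)) r → Fin n
    φ = [ ψ , uncurry X.block ]

    φ-injective : Injective _≡_ _≡_ φ
    φ-injective = [,]-injective ψ-injective X.block-injective
                    (λ v (i , a) eq → X.block-∉U i a (subst (_∈ ψ-image) eq (ψ∈ψ-image v)))

    edgeImage : ∀ i → List (Fin n)
    edgeImage i = ends i ++ map (X.block i) (allFin (r ∸ 2))

    edgeImage≡ : ∀ i → edgeImage i ≡ map φ (expansionEdge r (fanEdges t k) i)
    edgeImage≡ i = cong (ends i ++_) (map-∘ (allFin (r ∸ 2)))

    edgeImage-unique : ∀ i → Unique (edgeImage i)
    edgeImage-unique i = Uniqueₚ.++⁺ (ends-unique i)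
      (Uniqueₚ.map⁺ (λ eq → cong proj₂ (X.block-injective eq)) (Uniqueₚ.allFin⁺ (r ∸ 2)))
      (λ (v∈ends , v∈X) → let a , _ , v≡ = ∈-map⁻ (X.block i) {xs = allFin (r ∸ 2)} v∈X in
                       X.block-∉K i a (subst (_∈ ends i) v≡ v∈ends))

    length-edgeImage : ∀ i → length (edgeImage i) ≡ r
    length-edgeImage i = begin-equality
      2 + length (map (X.block i) (allFin (r ∸ 2)))  ≡⟨ cong (2 +_) (length-map (X.block i) (allFin (r ∸ 2))) ⟩
      2 + length (allFin (r ∸ 2))                    ≡⟨ cong (2 +_) (length-tabulate {n = r ∸ 2} (λ a → a)) ⟩
      2 + (r ∸ 2)                                    ≡⟨ m+[n∸m]≡n 2≤r ⟩
      r                                              ∎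
      where open ≤-Reasoning

    covered : ∀ i → Any (λ h → map φ (expansionEdge r (fanEdges t k) i) ↭ h) (edges H)
    covered i = cover (X.block-edge i)
      where
      cover : (∃ λ g → g ∈ level 0 × ends i ⊆ g × (∀ a → X.block i a ∈ g)) →
              Any (λ h → map φ (expansionEdge r (fanEdges t k) i) ↭ h) (edges H)
      cover (g , g∈ , ends⊆g , block∈g) = lose g∈ (subst (_↭ g) (edgeImage≡ i)
        (Unique-⊆-length≤⇒↭ (edgeImage-unique i)
          (λ v∈ → [ ends⊆g , map-⊆ {f = X.block i} {xs = allFin (r ∸ 2)} block∈g ]
                    (∈-++⁻ (ends i) {ys = map (X.block i) (allFin (r ∸ 2))} v∈))
          (≤-reflexive (trans (proj₁ (All.lookup (uniform H) g∈)) (sym (length-edgeImage i))))))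

  embed-fan : ∀ {e} → e ∈ level (r + r) → Contains H (fanExp r t k)
  embed-fan {[]}    e∈ = contradiction (proj₁ (All.lookup (level-uniform (r + r)) e∈)) (<⇒≢ (≤-trans (s≤s z≤n) 2≤r))
  embed-fan {_ ∷ _} e∈ = φ e∈ , φ-injective e∈ , All-tabulate⁺ (covered e∈)

  Free⇒∣E∣≤ : Free H (fanExp r t k) → ∣E∣ H ≤ (r + r) * fanThreshold r t k * n ^ (r ∸ 1)
  Free⇒∣E∣≤ free = begin
    ∣E∣ H                                        ≤⟨ ∣E∣≤∣level∣+ (r + r) ⟩
    length (level (r + r)) + (r + r) * (s * nᵈ)  ≡⟨ cong (_+ (r + r) * (s * nᵈ)) (∀∉⇒length≡0 (free ∘ embed-fan)) ⟩
    (r + r) * (s * nᵈ)                           ≡⟨ *-assoc (r + r) s nᵈ ⟨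
    (r + r) * s * nᵈ                             ∎
    where
    open ≤-Reasoning
    s nᵈ : ℕ
    s  = fanThreshold r t k
    nᵈ = n ^ (r ∸ 1)

-- Expansions inside partite r-graphs

module EmbeddedExpansion {V : Set} {r : ℕ} {E : List (V × V)} {n : ℕ} (H : RGraph r n)
                         (φ : ExpVertex V (length E) r → Fin n) (φ-injective : Injective _≡_ _≡_ φ)
                         (covered : All (λ e → Any (λ h → map φ e ↭ h) (edges H)) (expansion r E)) where

  image-edge : ∀ i → ∃ λ h → h ∈ edges H × map φ (expansionEdge r E i) ↭ h
  image-edge i = find∈ (All-tabulate⁻ covered i)

  endpoints-covered : ∀ {u w} → (u , w) ∈ E → ∃ λ h → h ∈ edges H × φ (inj₁ u) ∈ h × φ (inj₁ w) ∈ h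
  endpoints-covered uw∈ with h , h∈ , ↭h ← image-edge (index uw∈) =
    h , h∈ , ∈-resp-↭ ↭h (here (cong (φ ∘ inj₁ ∘ proj₁) (lookup-index uw∈))) ,
             ∈-resp-↭ ↭h (there (here (cong (φ ∘ inj₁ ∘ proj₂) (lookup-index uw∈))))

  ∈-expansionEdge-inj₁ : ∀ {u w x} (uw∈ : (u , w) ∈ E) → inj₁ x ∈ expansionEdge r E (index uw∈) → x ≡ u ⊎ x ≡ w
  ∈-expansionEdge-inj₁ uw∈ (here eq)         = inj₁ (trans (inj₁-injective eq) (sym (cong proj₁ (lookup-index uw∈))))
  ∈-expansionEdge-inj₁ uw∈ (there (here eq)) = inj₂ (trans (inj₁-injective eq) (sym (cong proj₂ (lookup-index uw∈))))
  ∈-expansionEdge-inj₁ uw∈ (there (there x∈)) with _ , _ , () ← ∈-map⁻ _ x∈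

  ∈-expansionEdge-inj₂ : ∀ {i i′ j} → inj₂ (i′ , j) ∈ expansionEdge r E i → i′ ≡ i
  ∈-expansionEdge-inj₂ (there (there x∈)) with _ , _ , eq ← ∈-map⁻ _ x∈ = cong proj₁ (inj₂-injective eq)

  proper-colouring⇒no-clique : ∀ {c k} (colour : Fin n → Fin c) →
                               (∀ {h y y′} → h ∈ edges H → y ∈ h → y′ ∈ h → colour y ≡ colour y′ → y ≡ y′) →
                               c < k → (w : Fin k → V) → Injective _≡_ _≡_ w → (∀ {i j} → i <ᶠ j → (w i , w j) ∈ E) → ⊥
  proper-colouring⇒no-clique colour proper c<k w w-injective adjacent
    with i , j , i<j , same ← pigeonhole c<k (colour ∘ φ ∘ inj₁ ∘ w)
    with h , h∈ , wi∈ , wj∈ ← endpoints-covered (adjacent i<j)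
    = <ᶠ⇒≢ i<j (w-injective (inj₁-injective (φ-injective (proper h∈ wi∈ wj∈ same))))

  common-vertex⇒no-triangle : ∀ {a b c} (z : Fin n) → (∀ {h} → h ∈ edges H → z ∈ h) → a ≢ b → a ≢ c → b ≢ c →
                              (a , b) ∈ E → (a , c) ∈ E → (b , c) ∈ E → ⊥
  common-vertex⇒no-triangle z central a≢b a≢c b≢c ab∈ ac∈ bc∈ =
    shared (preimage ab∈) (preimage ac∈) (preimage bc∈)
    where
    Preimage : ∀ {u w} → (u , w) ∈ E → Set
    Preimage uw∈ = ∃ λ v → v ∈ expansionEdge r E (index uw∈) × z ≡ φ v
    preimage : ∀ {u w} (uw∈ : (u , w) ∈ E) → Preimage uw∈
    preimage uw∈ with h , h∈ , ↭h ← image-edge (index uw∈) = ∈-map⁻ φ (∈-resp-↭ (↭-sym ↭h) (central h∈))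
    shared : Preimage ab∈ → Preimage ac∈ → Preimage bc∈ → ⊥
    shared (v , v∈ab , z≡) (v′ , v′∈ac , z≡′) (v″ , v″∈bc , z≡″)
      with refl ← φ-injective (trans (sym z≡) z≡′) | refl ← φ-injective (trans (sym z≡) z≡″)
      with v
    ... | inj₂ (i , j) = b≢c (cong proj₂ (trans (lookup-index ab∈)
                           (trans (cong (lookup E) (trans (sym (∈-expansionEdge-inj₂ v∈ab)) (∈-expansionEdge-inj₂ v′∈ac)))
                                  (sym (lookup-index ac∈)))))
    ... | inj₁ x with ∈-expansionEdge-inj₁ ab∈ v∈ab
    ...   | inj₁ refl = [ a≢b , a≢c ]′ (∈-expansionEdge-inj₁ bc∈ v″∈bc)
    ...   | inj₂ refl = [ a≢b ∘ sym , b≢c ]′ (∈-expansionEdge-inj₁ ac∈ v′∈ac)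

funToFin-cong : ∀ {a b} {f g : Fin a → Fin b} → (∀ i → f i ≡ g i) → funToFin f ≡ funToFin g
funToFin-cong {zero}  f≗g = refl
funToFin-cong {suc a} f≗g = cong₂ combine (f≗g zero) (funToFin-cong (f≗g ∘ suc))

finToFun-injective : ∀ {a b} {x y : Fin (b ^ a)} → (∀ i → finToFun {b} {a} x i ≡ finToFun y i) → x ≡ y
finToFun-injective {a} {b} {x} {y} eq = begin
  x                              ≡⟨ funToFin-finToFin {a} {b} x ⟨
  funToFin (finToFun {b} {a} x)  ≡⟨ funToFin-cong {a} {b} eq ⟩
  funToFin (finToFun {b} {a} y)  ≡⟨ funToFin-finToFin {a} {b} y ⟩
  y                              ∎
  where open ≡-Reasoning

module Partite (r m : ℕ) .{{_ : NonZero r}} {n : ℕ} (m*r≤n : m * r ≤ n) where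

  vertex : Fin m → Fin r → Fin n
  vertex a i = inject≤ (combine a i) m*r≤n

  part : Fin n → Fin r
  part y = fromℕ< (m%n<n (toℕ y) r)

  part-vertex : ∀ a i → part (vertex a i) ≡ i
  part-vertex a i = toℕ-injective (begin-equality
    toℕ (part (vertex a i))  ≡⟨ toℕ-fromℕ< (m%n<n (toℕ (vertex a i)) r) ⟩
    toℕ (vertex a i) % r     ≡⟨ cong (_% r) (toℕ-inject≤ (combine a i) m*r≤n) ⟩
    toℕ (combine a i) % r    ≡⟨ cong (_% r) (toℕ-combine a i) ⟩
    (r * toℕ a + toℕ i) % r  ≡⟨ cong (_% r) (trans (+-comm (r * toℕ a) (toℕ i)) (cong (toℕ i +_) (*-comm r (toℕ a)))) ⟩
    (toℕ i + toℕ a * r) % r  ≡⟨ [m+kn]%n≡m%n (toℕ i) (toℕ a) r ⟩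
    toℕ i % r                ≡⟨ m<n⇒m%n≡m (toℕ<n i) ⟩
    toℕ i                    ∎)
    where open ≤-Reasoning

  transversal : (Fin r → Fin m) → List (Fin n)
  transversal v = tabulate (λ i → vertex (v i) i)

  transversal-edge : ∀ v → Edge r (transversal v)
  transversal-edge v = length-tabulate _ ,
    Uniqueₚ.tabulate⁺ (λ {i} {j} eq → trans (sym (part-vertex (v i) i)) (trans (cong part eq) (part-vertex (v j) j)))

  transversal-↭ : ∀ {v w} → transversal v ↭ transversal w → ∀ i → v i ≡ w i
  transversal-↭ {v} {w} v↭w i with i′ , eq ← ∈-tabulate⁻ (∈-resp-↭ v↭w (∈-tabulate⁺ {f = λ i → vertex (v i) i} i))
    with refl ← trans (sym (part-vertex (v i) i)) (trans (cong part eq) (part-vertex (w i′) i′))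
    = proj₁ (combine-injective (v i) i (w i) i (inject≤-injective m*r≤n m*r≤n _ _ eq))

  module _ {M : ℕ} (code : Fin M → Fin r → Fin m) (code-injective : ∀ {x y} → (∀ i → code x i ≡ code y i) → x ≡ y) where

    partiteGraph : RGraph r n
    partiteGraph = record
      { edges   = map (transversal ∘ code) (allFin M)
      ; uniform = All-map⁺ (All.tabulate (λ _ → transversal-edge _))
      ; simple  = AllPairsₚ.map⁺ (AllPairs.map (λ x≢y x↭y → x≢y (code-injective (transversal-↭ x↭y))) (Uniqueₚ.allFin⁺ M))
      }

    ∣E∣-partiteGraph : ∣E∣ partiteGraph ≡ M
    ∣E∣-partiteGraph = trans (length-map _ (allFin M)) (length-tabulate {n = M} (λ x → x))

    ∈-partiteGraph : ∀ {h} → h ∈ edges partiteGraph → ∃ λ x → h ≡ transversal (code x)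
    ∈-partiteGraph h∈ with x , _ , eq ← ∈-map⁻ (transversal ∘ code) h∈ = x , eq

    part-proper : ∀ {h y y′} → h ∈ edges partiteGraph → y ∈ h → y′ ∈ h → part y ≡ part y′ → y ≡ y′
    part-proper h∈ y∈ y′∈ same with x , refl ← ∈-partiteGraph h∈
      with i , refl ← ∈-tabulate⁻ y∈ | i′ , refl ← ∈-tabulate⁻ y′∈
      with refl ← trans (sym (part-vertex _ i)) (trans same (part-vertex _ i′)) = refl

complete-partite-lower-bound : ∀ {r t k} .{{_ : NonZero r}} → r < suc k → ∀ {n} m → m * r ≤ n →
                               Σ (RGraph r n) λ H → Free H (fanExp r (suc t) (suc k)) × m ^ r ≤ ∣E∣ H
complete-partite-lower-bound {r} r<k m m*r≤n =
  H , (λ (φ , φ-injective , covered) → EmbeddedExpansion.proper-colouring⇒no-clique H φ φ-injective covered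
         part (part-proper finToFun finToFun-injective) r<k fanClique fanClique-injective fanClique-adjacent) ,
  ≤-reflexive (sym (∣E∣-partiteGraph finToFun finToFun-injective))
  where
  open Partite r m m*r≤n
  H : RGraph r _
  H = partiteGraph finToFun finToFun-injective

pinned-partite-lower-bound : ∀ {r t k n} m → suc m * suc r ≤ n →
                             Σ (RGraph (suc r) n) λ H → Free H (fanExp (suc r) (suc t) (3 + k)) × suc m ^ r ≤ ∣E∣ H
pinned-partite-lower-bound {r} m m*r≤n =
  H , (λ (φ , φ-injective , covered) → EmbeddedExpansion.common-vertex⇒no-triangle H φ φ-injective covered
         (vertex zero zero) central
         ((λ ()) ∘ fanClique-injective) ((λ ()) ∘ fanClique-injective) ((λ ()) ∘ fanClique-injective)
         (fanClique-adjacent {i = zero} {suc zero} (s≤s z≤n)) (fanClique-adjacent {i = zero} {suc (suc zero)} (s≤s z≤n))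
         (fanClique-adjacent {i = suc zero} {suc (suc zero)} (s≤s (s≤s z≤n)))) ,
  ≤-reflexive (sym (∣E∣-partiteGraph code code-injective))
  where
  open Partite (suc r) (suc m) m*r≤n
  code : Fin (suc m ^ r) → Fin (suc r) → Fin (suc m)
  code x zero    = zero
  code x (suc i) = finToFun x i
  code-injective : ∀ {x y} → (∀ i → code x i ≡ code y i) → x ≡ y
  code-injective eq = finToFun-injective (eq ∘ suc)
  H : RGraph (suc r) _
  H = partiteGraph code code-injective
  central : ∀ {h} → h ∈ edges H → vertex zero zero ∈ h
  central h∈ with x , refl ← ∈-partiteGraph code code-injective h∈ = ∈-tabulate⁺ {f = λ i → vertex (code x i) i} zero

^-distribʳ-* : ∀ a b d → (a * b) ^ d ≡ a ^ d * b ^ d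
^-distribʳ-* a b zero    = refl
^-distribʳ-* a b (suc d) = trans (cong (a * b *_) (^-distribʳ-* a b d)) (interchange a b (a ^ d) (b ^ d))

n≤[r+r]*[n/r] : ∀ {n r} .{{_ : NonZero r}} → r ≤ n → n ≤ (r + r) * (n / r)
n≤[r+r]*[n/r] {n} {r} r≤n = begin
  n                          ≡⟨ m≡m%n+[m/n]*n n r ⟩
  n % r + n / r * r          ≤⟨ +-monoˡ-≤ (n / r * r) (<⇒≤ (m%n<n n r)) ⟩
  r + n / r * r              ≡⟨ cong (_+ n / r * r) (*-identityʳ r) ⟨
  r * 1 + n / r * r          ≤⟨ +-monoˡ-≤ (n / r * r) (*-monoʳ-≤ r (m≥n⇒m/n>0 r≤n)) ⟩
  r * (n / r) + n / r * r    ≡⟨ cong (r * (n / r) +_) (*-comm (n / r) r) ⟩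
  r * (n / r) + r * (n / r)  ≡⟨ *-distribʳ-+ (n / r) r r ⟨
  (r + r) * (n / r)          ∎
  where open ≤-Reasoning

-- The lower-bound graphs are r-partite with parts of size m = ⌊n/r⌋, and n ≤ 2r·m turns m^d into n^d/(2r)^d.
ExTheta-intro : ∀ {V : Set} {r d} {F : List (List V)} .{{_ : NonZero r}} (C : ℕ) →
                (∀ {n} m → 1 ≤ m → m * r ≤ n → Σ (RGraph r n) λ H → Free H F × m ^ d ≤ ∣E∣ H) →
                (∀ {n} (H : RGraph r n) → Free H F → ∣E∣ H ≤ C * n ^ d) →
                ExTheta r F d
ExTheta-intro {r = r} {d} C lower upper = (r + r) ^ d , C , r , λ n r≤n →
  let H , free , large = lower (n / r) (m≥n⇒m/n>0 r≤n) (m/n*n≤m n r) in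
  (H , free , (begin
    n ^ d                      ≤⟨ ^-monoˡ-≤ d (n≤[r+r]*[n/r] r≤n) ⟩
    ((r + r) * (n / r)) ^ d    ≡⟨ ^-distribʳ-* (r + r) (n / r) d ⟩
    (r + r) ^ d * (n / r) ^ d  ≤⟨ *-monoʳ-≤ ((r + r) ^ d) large ⟩
    (r + r) ^ d * ∣E∣ H        ∎)) ,
  upper
  where open ≤-Reasoning

proposition2 : (r t k : ℕ) → 2 ≤ r → 1 ≤ t → 3 ≤ k →
    (r < k → ExTheta r (fanExp r t k) r)
    × (2 < k → k ≤ r → ExTheta r (fanExp r t k) (r ∸ 1))
proposition2 r@(suc r′) t@(suc _) k@(suc (suc (suc _))) 2≤r@(s≤s _) (s≤s _) (s≤s (s≤s (s≤s _))) = dense , sparse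
  where
  dense : r < k → ExTheta r (fanExp r t k) r
  dense r<k = ExTheta-intro {d = r} 1 (λ m _ → complete-partite-lower-bound r<k m) (λ H _ → ∣E∣≤n^r H)
  sparse : 2 < k → k ≤ r → ExTheta r (fanExp r t k) r′
  sparse _ k≤r = ExTheta-intro {d = r′} ((r + r) * fanThreshold r t k)
    (λ { (suc m) _ → pinned-partite-lower-bound m })
    (λ H → FanEmbedding.Free⇒∣E∣≤ 2≤r (s≤s z≤n) k≤r H)
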